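{- Let $G$ be a graph with a skeleton $\mathcal S=(F,D)$, let $H$ be a graph, let $\chi:V(H)\to V(G)\setminus(F\cup D)$, and let $P=P(G,\mathcal S,H,\chi)$, with $\pi_1(u,z)=u$ for $(u,z)\in V(P)$. Let $h$ be a homomorphism from $G$ to $P$ such that $\pi_1\circ h$ is an automorphism of $G$. Then there is a homomorphism $\bar h$ from $(G\setminus F)/D$ to $H$ such that $\chi(\bar h(v))=v$ for every $v\in V(G)\setminus(F\cup D)$; in particular $\bar h$ is an embedding.
   Context: All graphs are finite, simple, undirected. A homomorphism $G\to H$ is a map $h:V(G)\to V(H)$ with $h(u)h(v)\in E(H)$ whenever $uv\in E(G)$; an embedding is an injective homomorphism; an endomorphism of $G$ is a homomorphism $G\to G$, an automorphism is an embedding $G\to G$. $G\setminus X$ denotes $G$ with the vertex set $X$ deleted. Quotient: for a graph $K$ and $D\subseteq V(K)$ such that every vertex of $D$ has degree at most $2$ in $K$, $K/D$ has vertex set $V(K)\setminus D$, and distinct $u,v$ are adjacent iff $K$ has a path from $u$ to $v$ whose internal vertices all lie in $D$. A vertex $x\in D$ is associated with a vertex $v$ of $K/D$ if $x$ lies on a path in $K$ between $v$ and some $w\in D$ of degree $1$ in $K$ whose internal vertices are all in $D$; $x$ is associated with an edge $vw$ of $K/D$ if $x$ lies on a path in $K$ between $v$ and $w$ whose internal vertices are all in $D$ (each $x$ is associated with at most one vertex or edge, not both). Frame: $F\subseteq V(G)$ is a frame for $G$ if every endomorphism $h$ of $G$ with $F\subseteq h(V(G))$ is surjective. Skeleton: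 a pair $(F,D)$ of subsets of $V(G)$ such that $F$ is a frame for $G$, $F\cap D=\emptyset$, and every $v\in D$ has at most $2$ neighbours in $V(G)\setminus F$. Below, "associated" refers to $K=G\setminus F$ and $K/D=(G\setminus F)/D$. Product graph $P=P(G,\mathcal S,H,\chi)$ for a skeleton $\mathcal S=(F,D)$, a graph $H$ and $\chi:V(H)\to V(G)\setminus(F\cup D)$: $V(P)=V_1\cup V_2\cup V_3\cup V_4$ where $V_1=\{(u,a)\mid u\in V(G)\setminus(F\cup D), a\in V(H), \chi(a)=u\}$; $V_2=\{(u,u)\mid u\in F$, or $u\in D$ is associated with no vertex and no edge of $(G\setminus F)/D\}$; $V_3=\{(u,\mathbf v_{u,a})\mid u\in D, a\in V(H), u$ is associated with the vertex $\chi(a)\}$; $V_4=\{(u,\mathbf v_{u,e})\mid u\in D, e=\{a,b\}\in E(H), u$ is associated with the edge $\{\chi(a),\chi(b)\}\}$, where all $\mathbf v_{u,a},\mathbf v_{u,e}$ are fresh elements. Edges (in all cases $uv\in E(G)$ is required): $(u,a)(v,b)$ for $(u,a),(v,b)\in V_1$ with $ab\in E(H)$; $(u,a)(v,v)$ for $(u,a)\in V_1$, $(v,v)\in V_2$; $(u,a)(v,\mathbf v_{v,a})$ for $(u,a)\in V_1$, $(v,\mathbf v_{v,a})\in V_3$; $(u,a)(v,\mathbf v_{v,e})$ for $(u,a)\in V_1$, $(v,\mathbf v_{v,e})\in V_4$ with $a\in e$; $(u,u)(v,v)$ for both in $V_2$; $(u,u)(v,z)$ for $(u,u)\in V_2$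 and $(v,z)\in V_3\cup V_4$; $(u,\mathbf v_{u,a})(v,\mathbf v_{v,a})$ for both in $V_3$ (same $a$); $(u,\mathbf v_{u,e})(v,\mathbf v_{v,e})$ for both in $V_4$ (same $e$); no edges between $V_3$ and $V_4$. -}

module Defs where

open import Data.Nat using (ℕ; zero; suc; _+_; _≤_)
open import Data.Fin using (Fin; _<_)
import Data.Fin as Fin
open import Data.Bool using (Bool; true; false; _∧_; not; if_then_else_)
open import Data.List using (List; []; _∷_; _++_; [_])
open import Data.List.Relation.Unary.All using (All)
open import Data.List.Relation.Unary.Linked using (Linked)
open import Data.List.Relation.Unary.Unique.Propositional using (Unique)
open import Data.List.Membership.Propositional using (_∈_)
open import Data.Product using (Σ; ∃; _×_; _,_; proj₁; proj₂)
open import Data.Sum using (_⊎_)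
open import Data.Unit using (⊤)
open import Data.Empty using (⊥)
open import Relation.Nullary using (¬_)
open import Relation.Binary.PropositionalEquality using (_≡_; _≢_)

record Graph : Set where
  field
    n    : ℕ
    adj  : Fin n → Fin n → Bool
    sym  : ∀ u v → adj u v ≡ adj v u
    irr  : ∀ u → adj u u ≡ false

open Graph public

V : Graph → Set
V G = Fin (n G)

E : (G : Graph) → V G → V G → Set
E G u v = adj G u v ≡ true

VSet : Graph → Set
VSet G = V G → Bool

count : ∀ {k} → (Fin k → Bool) → ℕ
count {zero}  f = 0
count {suc k} f = (if f Fin.zero then 1 else 0) + count (λ i → f (Fin.suc i))

-- homomorphism G → G (endomorphism), automorphism (= embedding G → G)
IsEndo : (G : Graph) → (V G → V G) → Set
IsEndo G h = ∀ u v → E G u v → E G (h u) (h v)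

IsAuto : (G : Graph) → (V G → V G) → Set
IsAuto G h = IsEndo G h × (∀ u v → h u ≡ h v → u ≡ v)

IsHom : (G H : Graph) → (V G → V H) → Set
IsHom G H h = ∀ u v → E G u v → E H (h u) (h v)

IsFrame : (G : Graph) → VSet G → Set
IsFrame G F = ∀ (h : V G → V G) → IsEndo G h
  → (∀ u → F u ≡ true → ∃ λ v → h v ≡ u)
  → ∀ u → ∃ λ v → h v ≡ u

degK : (G : Graph) → VSet G → V G → ℕ
degK G F v = count (λ w → adj G v w ∧ not (F w))

IsSkeleton : (G : Graph) → VSet G → VSet G → Set
IsSkeleton G F D =
  IsFrame G F
  × (∀ u → F u ≡ true → D u ≡ false)
  × (∀ v → D v ≡ true → degK G F v ≤ 2)

module Quotient (G : Graph) (F D : VSet G) where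

  pathList : V G → List (V G) → V G → List (V G)
  pathList u ys v = u ∷ ys ++ [ v ]

  IsPathD : V G → List (V G) → V G → Set
  IsPathD u ys v =
    All (λ x → F x ≡ false) (pathList u ys v)
    × All (λ x → D x ≡ true) ys
    × Unique (pathList u ys v)
    × Linked (E G) (pathList u ys v)

  InKD : V G → Set
  InKD v = F v ≡ false × D v ≡ false

  VKD : Set
  VKD = Σ (V G) InKD

  AdjKD : VKD → VKD → Set
  AdjKD (u , _) (v , _) = u ≢ v × ∃ λ ys → IsPathD u ys v

  AssocV : V G → V G → Set
  AssocV x v = InKD v × ∃ λ w → ∃ λ ys →
    D w ≡ true × degK G F w ≡ 1 × IsPathD v ys w × x ∈ pathList v ys w

  AssocE : V G → V G → V G → Set
  AssocE x v w = InKD v × InKD w × v ≢ w × ∃ λ ys →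
    IsPathD v ys w × x ∈ pathList v ys w

module Product (G H : Graph) (F D : VSet G) (χ : V H → V G) where
  open Quotient G F D

  -- vertices of P; membership conditions are irrelevant fields, so the
  -- vertex (u, z) is determined by its data.  An edge e = {a,b} of H is
  -- represented by the ordered pair (a, b) with a < b.
  data PV : Set where
    -- V1 : (χ a, a)
    v1 : (a : V H) → PV
    -- V2 : (u, u)
    v2 : (u : V G) →
         .(F u ≡ true ⊎ (D u ≡ true × ¬ (∃ λ v → AssocV u v)
                                    × ¬ (∃ λ v → ∃ λ w → AssocE u v w))) → PV
    -- V3 : (u, v_{u,a})
    v3 : (u : V G) (a : V H) → .(D u ≡ true) → .(AssocV u (χ a)) → PV
    -- V4 : (u, v_{u,{a,b}})
    v4 : (u : V G) (a b : V H) → .(a < b) → .(E H a b) → .(D u ≡ true)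
         → .(AssocE u (χ a) (χ b)) → PV

  π₁ : PV → V G
  π₁ (v1 a)             = χ a
  π₁ (v2 u _)           = u
  π₁ (v3 u _ _ _)       = u
  π₁ (v4 u _ _ _ _ _ _) = u

  -- the extra condition on an edge (besides π₁ p π₁ q ∈ E(G)), oriented
  E' : PV → PV → Set
  E' (v1 a) (v1 b)                = E H a b
  E' (v1 a) (v2 _ _)              = ⊤
  E' (v1 a) (v3 _ a' _ _)         = a ≡ a'
  E' (v1 a) (v4 _ a' b' _ _ _ _)  = a ≡ a' ⊎ a ≡ b'
  E' (v2 _ _) (v2 _ _)            = ⊤
  E' (v2 _ _) (v3 _ _ _ _)        = ⊤
  E' (v2 _ _) (v4 _ _ _ _ _ _ _)  = ⊤
  E' (v3 _ a _ _) (v3 _ a' _ _)   = a ≡ a'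
  E' (v4 _ a b _ _ _ _) (v4 _ a' b' _ _ _ _) = a ≡ a' × b ≡ b'
  E' _ _ = ⊥

  EP : PV → PV → Set
  EP p q = E G (π₁ p) (π₁ q) × (E' p q ⊎ E' q p)

  IsHomToP : (V G → PV) → Set
  IsHomToP h = ∀ u v → E G u v → EP (h u) (h v)

-- π₁ ∘ h is an automorphism of a finite graph, so its inverse is an iterate of it and hence a
-- homomorphism; k = h ∘ (π₁ ∘ h)⁻¹ is then a homomorphism G → P that is a section of π₁.
-- A vertex x of K/D can only be sent by k to a vertex (x , a) of V₁, which defines h̄ x = a.
-- Along a path of K/D from x to y through D every interior vertex is associated with the edge
-- xy, so k sends it into V₃ ∪ V₄; consecutive vertices of V₃ ∪ V₄ carry the same a or e, so
-- the whole interior is attached to h̄ x and to h̄ y, which forces h̄ x h̄ y ∈ E(H).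
module Submission where

open import Defs
open import Data.Product using (Σ; ∃; _×_; _,_; proj₁; proj₂)
open import Data.Bool using (Bool; true; false)
open import Relation.Binary.PropositionalEquality using (_≡_)
open import Function using (_∘_)

open import Data.Bool.Properties using (_≟_)
open import Data.Empty using (⊥; ⊥-elim)
import Data.Empty.Irrelevant as Irrelevant
open import Data.Fin using (toℕ)
open import Data.Fin.Properties using (pigeonhole)
open import Data.List using ([]; _∷_; _++_; [_])
open import Data.List.Membership.Propositional.Properties using (∈-++⁺ˡ)
open import Data.List.Relation.Unary.All as All using (All; []; _∷_)
open import Data.List.Relation.Unary.Any using (there)
open import Data.List.Relation.Unary.Linked using (Linked; [-]; _∷_)
open import Data.Nat using (ℕ; zero; suc; _+_; _*_)
open import Data.Nat.GeneralisedArithmetic using (fold; fold-+)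
open import Data.Nat.Properties using (n<1+n; +-suc; *-comm; m≤n⇒∃[o]m+o≡n)
open import Data.Sum using (_⊎_; inj₁; inj₂)
open import Data.Unit using (⊤; tt)
open import Function.Definitions using (Injective)
import Relation.Binary.PropositionalEquality as ≡
open import Relation.Binary.PropositionalEquality using (refl; _≢_; cong; subst; subst₂)
open import Relation.Nullary using (¬_)
open import Relation.Nullary.Decidable using (recompute)

≡false⇒≢true : ∀ {b : Bool} → b ≡ false → b ≢ true
≡false⇒≢true refl ()

-- fold u σ m is σᵐ u.
module _ {A : Set} (σ : A → A) where

  fold-periodic : ∀ {u} p → fold u σ p ≡ u → ∀ q → fold u σ (q * p) ≡ u
  fold-periodic p periodic zero = refl
  fold-periodic {u} p periodic (suc q) = begin
    fold u σ (p + q * p)       ≡⟨ fold-+ u σ p ⟩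
    fold (fold u σ (q * p)) σ p ≡⟨ cong (λ w → fold w σ p) (fold-periodic p periodic q) ⟩
    fold u σ p                 ≡⟨ periodic ⟩
    u                          ∎
    where open ≡.≡-Reasoning

  fold-injective : Injective _≡_ _≡_ σ → ∀ {u v} m → fold u σ m ≡ fold v σ m → u ≡ v
  fold-injective σ-inj zero eq = eq
  fold-injective σ-inj (suc m) eq = fold-injective σ-inj m (σ-inj eq)

module _ (G : Graph) (σ : V G → V G) where

  fold-preserves-E : IsEndo G σ → ∀ m {u v} → E G u v → E G (fold u σ m) (fold v σ m)
  fold-preserves-E σ-endo zero e = e
  fold-preserves-E σ-endo (suc m) e = σ-endo _ _ (fold-preserves-E σ-endo m e)

  module _ (σ-inj : Injective _≡_ _≡_ σ) where

    -- Pigeonhole on u, σ u, …, σⁿ u gives σⁱ u ≡ σⁱ⁺ᵖ u with p > 0; cancel σⁱ.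
    fold-returns : ∀ u → ∃ λ d → fold u σ (suc d) ≡ u
    fold-returns u with pigeonhole (n<1+n (n G)) (λ i → fold u σ (toℕ i))
    ... | i , j , i<j , σⁱu≡σʲu with m≤n⇒∃[o]m+o≡n i<j
    ... | o , i+1+o≡j = o , ≡.sym (fold-injective σ σ-inj (toℕ i) (begin
      fold u σ (toℕ i)                    ≡⟨ σⁱu≡σʲu ⟩
      fold u σ (toℕ j)                    ≡⟨ cong (fold u σ) (≡.sym (≡.trans (+-suc (toℕ i) o) i+1+o≡j)) ⟩
      fold u σ (toℕ i + suc o)            ≡⟨ fold-+ u σ (toℕ i) ⟩
      fold (fold u σ (suc o)) σ (toℕ i)   ∎))
      where open ≡.≡-Reasoning

    inverse : V G → V G
    inverse u = fold u σ (proj₁ (fold-returns u))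

    σ∘inverse : ∀ u → σ (inverse u) ≡ u
    σ∘inverse u = proj₂ (fold-returns u)

    -- σ^Q with Q + 1 a common period of u and v is a homomorphism inverting σ at u and v.
    inverse-preserves-E : IsEndo G σ → IsEndo G inverse
    inverse-preserves-E σ-endo u v e =
      subst₂ (E G) (inverse-unique u returnsᵘ) (inverse-unique v returnsᵛ)
        (fold-preserves-E σ-endo Q e)
      where
      du dv Q : ℕ
      du = proj₁ (fold-returns u)
      dv = proj₁ (fold-returns v)
      Q = dv + du * suc dv
      inverse-unique : ∀ w → σ (fold w σ Q) ≡ w → fold w σ Q ≡ inverse w
      inverse-unique w eq = σ-inj (≡.trans eq (≡.sym (σ∘inverse w)))
      returnsᵘ : σ (fold u σ Q) ≡ u
      returnsᵘ = subst (λ m → fold u σ m ≡ u) (*-comm (suc dv) (suc du))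
        (fold-periodic σ (suc du) (σ∘inverse u) (suc dv))
      returnsᵛ : σ (fold v σ Q) ≡ v
      returnsᵛ = fold-periodic σ (suc dv) (σ∘inverse v) (suc du)

module _ {G H : Graph} {F D : VSet G} {χ : V H → V G}
         (χ-inKD : ∀ a → Quotient.InKD G F D (χ a)) where
  open Quotient G F D
  open Product G H F D χ

  inKD⇒V₁ : ∀ p → InKD (π₁ p) → ∃ λ a → p ≡ v1 a
  inKD⇒V₁ (v1 a) _ = a , refl
  inKD⇒V₁ (v2 u inV₂) (¬Fu , ¬Du) = Irrelevant.⊥-elim (notV₂ inV₂)
    where
    notV₂ : F u ≡ true ⊎ (D u ≡ true × _) → ⊥
    notV₂ (inj₁ Fu) = ≡false⇒≢true ¬Fu Fu
    notV₂ (inj₂ (Du , _)) = ≡false⇒≢true ¬Du Du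
  inKD⇒V₁ (v3 u a Du _) (_ , ¬Du) = Irrelevant.⊥-elim (≡false⇒≢true ¬Du Du)
  inKD⇒V₁ (v4 u a b _ _ Du _) (_ , ¬Du) = Irrelevant.⊥-elim (≡false⇒≢true ¬Du Du)

  InV₃₄ : PV → Set
  InV₃₄ (v3 _ _ _ _) = ⊤
  InV₃₄ (v4 _ _ _ _ _ _ _) = ⊤
  InV₃₄ _ = ⊥

  associatedWithEdge⇒V₃₄ : ∀ p {z v w} → π₁ p ≡ z → F z ≡ false → D z ≡ true
    → AssocE z v w → InV₃₄ p
  associatedWithEdge⇒V₃₄ (v1 a) refl _ Dχa _ = ⊥-elim (≡false⇒≢true (proj₂ (χ-inKD a)) Dχa)
  associatedWithEdge⇒V₃₄ (v2 u inV₂) {v = v} {w} refl ¬Fu _ assoc = Irrelevant.⊥-elim (notV₂ inV₂)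
    where
    notV₂ : F u ≡ true ⊎ (D u ≡ true × _ × ¬ (∃ λ v → ∃ λ w → AssocE u v w)) → ⊥
    notV₂ (inj₁ Fu) = ≡false⇒≢true ¬Fu Fu
    notV₂ (inj₂ (_ , _ , unassociated)) = unassociated (v , w , assoc)
  associatedWithEdge⇒V₃₄ (v3 _ _ _ _) _ _ _ _ = tt
  associatedWithEdge⇒V₃₄ (v4 _ _ _ _ _ _ _) _ _ _ _ = tt

  Attached : V H → PV → Set
  Attached a (v3 _ c _ _) = a ≡ c
  Attached a (v4 _ c d _ _ _ _) = a ≡ c ⊎ a ≡ d
  Attached a _ = ⊥

  EP-sym : ∀ {p q} → EP p q → EP q p
  EP-sym (e , inj₁ e') = ≡.trans (Graph.sym G _ _) e , inj₂ e'
  EP-sym (e , inj₂ e') = ≡.trans (Graph.sym G _ _) e , inj₁ e'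

  EP-V₁-V₁ : ∀ {a b} → EP (v1 a) (v1 b) → E H a b
  EP-V₁-V₁ (_ , inj₁ e) = e
  EP-V₁-V₁ (_ , inj₂ e) = ≡.trans (Graph.sym H _ _) e

  EP-V₁-V₃₄ : ∀ {a} q → EP (v1 a) q → InV₃₄ q → Attached a q
  EP-V₁-V₃₄ (v3 _ _ _ _) (_ , inj₁ a≡c) _ = a≡c
  EP-V₁-V₃₄ (v4 _ _ _ _ _ _ _) (_ , inj₁ a∈e) _ = a∈e

  EP-V₃₄-V₃₄ : ∀ {a} p q → EP p q → InV₃₄ p → Attached a q → Attached a p
  EP-V₃₄-V₃₄ (v3 _ _ _ _) (v3 _ _ _ _) (_ , inj₁ refl) _ attached = attached
  EP-V₃₄-V₃₄ (v3 _ _ _ _) (v3 _ _ _ _) (_ , inj₂ refl) _ attached = attached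
  EP-V₃₄-V₃₄ (v4 _ _ _ _ _ _ _) (v4 _ _ _ _ _ _ _) (_ , inj₁ (refl , refl)) _ attached = attached
  EP-V₃₄-V₃₄ (v4 _ _ _ _ _ _ _) (v4 _ _ _ _ _ _ _) (_ , inj₂ (refl , refl)) _ attached = attached

  attached-distinct⇒E : ∀ {a b} p → a ≢ b → Attached a p → Attached b p → E H a b
  attached-distinct⇒E (v3 _ _ _ _) a≢b refl refl = ⊥-elim (a≢b refl)
  attached-distinct⇒E (v4 _ c d _ cd _ _) a≢b (inj₁ refl) (inj₂ refl) =
    recompute (_≟_ (adj H c d) true) cd
  attached-distinct⇒E (v4 _ c d _ cd _ _) a≢b (inj₂ refl) (inj₁ refl) =
    ≡.trans (Graph.sym H d c) (recompute (_≟_ (adj H c d) true) cd)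
  attached-distinct⇒E (v4 _ _ _ _ _ _ _) a≢b (inj₁ refl) (inj₁ refl) = ⊥-elim (a≢b refl)
  attached-distinct⇒E (v4 _ _ _ _ _ _ _) a≢b (inj₂ refl) (inj₂ refl) = ⊥-elim (a≢b refl)

  interior-associated : ∀ {x y ys} → InKD x → InKD y → x ≢ y → IsPathD x ys y
    → All (λ z → F z ≡ false × D z ≡ true × AssocE z x y) ys
  interior-associated inKDx inKDy x≢y path@(notF , inD , _) = All.tabulate λ z∈ys →
    let z∈path = there (∈-++⁺ˡ z∈ys) in
    All.lookup notF z∈path , All.lookup inD z∈ys , inKDx , inKDy , x≢y , _ , path , z∈path

  module Section (k : V G → PV) (k-hom : IsHomToP k) (π₁∘k : ∀ u → π₁ (k u) ≡ u) where

    attached-along : ∀ {z zs y b} → All (InV₃₄ ∘ k) (z ∷ zs) → Linked (E G) (z ∷ zs ++ [ y ])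
      → k y ≡ v1 b → Attached b (k z)
    attached-along {zs = []} (kz∈V₃₄ ∷ []) (e ∷ [-]) ky≡v1b =
      EP-V₁-V₃₄ _ (EP-sym (subst (EP _) ky≡v1b (k-hom _ _ e))) kz∈V₃₄
    attached-along {zs = _ ∷ _} (kz∈V₃₄ ∷ rest) (e ∷ path) ky≡v1b =
      EP-V₃₄-V₃₄ _ _ (k-hom _ _ e) kz∈V₃₄ (attached-along rest path ky≡v1b)

    hbar : VKD → V H
    hbar (x , inKDx) = proj₁ (inKD⇒V₁ (k x) (subst InKD (≡.sym (π₁∘k x)) inKDx))

    k≡v1∘hbar : ∀ x → k (proj₁ x) ≡ v1 (hbar x)
    k≡v1∘hbar (x , inKDx) = proj₂ (inKD⇒V₁ (k x) (subst InKD (≡.sym (π₁∘k x)) inKDx))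

    χ∘hbar : ∀ x → χ (hbar x) ≡ proj₁ x
    χ∘hbar x = ≡.trans (cong π₁ (≡.sym (k≡v1∘hbar x))) (π₁∘k (proj₁ x))

    hbar-injective : ∀ x y → hbar x ≡ hbar y → proj₁ x ≡ proj₁ y
    hbar-injective x y eq = ≡.trans (≡.sym (χ∘hbar x)) (≡.trans (cong χ eq) (χ∘hbar y))

    hbar-preserves-E : ∀ x y → AdjKD x y → E H (hbar x) (hbar y)
    hbar-preserves-E x y (_ , [] , _ , _ , _ , e ∷ [-]) =
      EP-V₁-V₁ (subst₂ EP (k≡v1∘hbar x) (k≡v1∘hbar y) (k-hom _ _ e))
    hbar-preserves-E x@(_ , inKDx) y@(_ , inKDy) (x≢y , z ∷ zs , path@(_ , _ , _ , e ∷ edges)) =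
      attached-distinct⇒E (k z) (x≢y ∘ hbar-injective x y)
        (EP-V₁-V₃₄ (k z) (subst (λ p → EP p (k z)) (k≡v1∘hbar x) (k-hom _ _ e)) kz∈V₃₄)
        (attached-along interior∈V₃₄ edges (k≡v1∘hbar y))
      where
      interior∈V₃₄ : All (InV₃₄ ∘ k) (z ∷ zs)
      interior∈V₃₄ = All.map
        (λ { {w} (¬Fw , Dw , assoc) → associatedWithEdge⇒V₃₄ (k w) (π₁∘k w) ¬Fw Dw assoc })
        (interior-associated inKDx inKDy x≢y path)
      kz∈V₃₄ : InV₃₄ (k z)
      kz∈V₃₄ = All.head interior∈V₃₄

lemma4p10 : (G H : Graph) (F D : VSet G) → IsSkeleton G F D
    → (χ : V H → V G) → (∀ a → Quotient.InKD G F D (χ a))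
    → (h : V G → Product.PV G H F D χ) → Product.IsHomToP G H F D χ h
    → IsAuto G (Product.π₁ G H F D χ ∘ h)
    → Σ (Quotient.VKD G F D → V H) λ hbar →
        (∀ x y → Quotient.AdjKD G F D x y → E H (hbar x) (hbar y))
        × (∀ x → χ (hbar x) ≡ proj₁ x)
        × (∀ x y → hbar x ≡ hbar y → proj₁ x ≡ proj₁ y)
lemma4p10 G H F D _ χ χ-inKD h h-hom (σ-endo , σ-inj) =
  hbar , hbar-preserves-E , χ∘hbar , hbar-injective
  where
  σ σ⁻¹ : V G → V G
  σ = Product.π₁ G H F D χ ∘ h
  σ-injective : Injective _≡_ _≡_ σ
  σ-injective = σ-inj _ _
  σ⁻¹ = inverse G σ σ-injective
  open Section χ-inKD (h ∘ σ⁻¹)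
    (λ u v e → h-hom _ _ (inverse-preserves-E G σ σ-injective σ-endo u v e))
    (σ∘inverse G σ σ-injective)
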